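{- Let $r\geq 2$ and $d\geq 1$ be integers, and let $V_1,\dots,V_r$ be the colour classes of a proper $r$-colouring of a graph $H$. Suppose that $|V_i|\geq 2e(2r-3)d$ for all $i\in\{1,\dots,r\}$, and that the induced subgraph $H[V_i\cup V_j]$ is $d$-degenerate for all distinct $i,j\in\{1,\dots,r\}$. Then there is an independent set $\{x_1,\dots,x_r\}$ of $H$ with $x_i\in V_i$ for each $i$.
   Context: Here $e=2.718\ldots$ is Euler's number. A graph is $d$-degenerate if every subgraph has a vertex of degree at most $d$. -}

module Defs where

open import Data.Nat using (ℕ; zero; suc; _+_; _*_; _≤_)
open import Data.Nat using (_!)
open import Data.Bool using (Bool; true; false; _∧_)
open import Data.Fin using (Fin; zero; suc; _≟_)
open import Relation.Nullary using (yes; no)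
open import Data.Product using (Σ; _×_; ∃)
open import Relation.Binary.PropositionalEquality using (_≡_; _≢_)

record Graph (n : ℕ) : Set where
  field
    Adj    : Fin n → Fin n → Bool
    sym    : ∀ u v → Adj u v ≡ Adj v u
    irrefl : ∀ v → Adj v v ≡ false
open Graph public

VSet : ℕ → Set
VSet n = Fin n → Bool

count : ∀ {n} → VSet n → ℕ
count {zero}  S = 0
count {suc n} S = if′ (S zero) + count (λ i → S (suc i))
  where
  if′ : Bool → ℕ
  if′ true  = 1
  if′ false = 0

_⊆_ : ∀ {n} → VSet n → VSet n → Set
S ⊆ W = ∀ v → S v ≡ true → W v ≡ true

_∪_ : ∀ {n} → VSet n → VSet n → VSet n
(S ∪ W) v with S v
... | true  = true
... | false = W v

degIn : ∀ {n} → Graph n → VSet n → Fin n → ℕ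
degIn H S v = count (λ u → S u ∧ Adj H v u)

Degenerate : ∀ {n} → ℕ → Graph n → VSet n → Set
Degenerate d H W =
  ∀ (S : VSet _) → S ⊆ W → (∃ λ v → S v ≡ true) →
  ∃ λ v → (S v ≡ true) × (degIn H S v ≤ d)

ProperColouring : ∀ {n} → Graph n → (r : ℕ) → (Fin n → Fin r) → Set
ProperColouring H r c = ∀ u v → Adj H u v ≡ true → c u ≢ c v

class : ∀ {n r} → (Fin n → Fin r) → Fin r → VSet n
class c i v with c v ≟ i
... | yes _ = true
... | no  _ = false

-- eNum N = Σ_{j=0}^{N} N!/j!, so eNum N / N! = Σ_{j≤N} 1/j!, the N-th
-- partial sum of the series for e.
eNum : ℕ → ℕ
eNum zero    = 1
eNum (suc N) = suc N * eNum N + 1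

-- "m ≥ e · c" for naturals m, c (e Euler's number). Since the partial sums
-- Σ_{j≤N} 1/j! increase to e, m ≥ e·c iff c·Σ_{j≤N} 1/j! ≤ m for all N,
-- i.e. c · eNum N ≤ m · N! for all N.
AtLeastETimes : ℕ → ℕ → Set
AtLeastETimes m c = ∀ N → c * eNum N ≤ m * (N !)

-- Pick x_i ∈ V_i uniformly and
-- independently; the bad events are "x_a ∼ x_b" for pairs of colours a ≠ b.
-- Since H[V_a ∪ V_b] is d-degenerate it has at most d(|V_a| + |V_b|) edges, so
-- each bad event has probability at most 1/(e(2r - 3)), and it is independent
-- of all events not sharing a colour with {a, b}: there are 2(r - 2) of those.
-- The symmetric Lovász Local Lemma then yields an outcome avoiding every bad
-- event.  All probabilities are replaced by counts of transversals.
module Submission where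

open import Defs hiding (sym)

open import Data.Bool using (Bool; true; false; _∧_; not)
open import Data.Bool.Properties using (∧-conicalˡ; ∧-conicalʳ; ∧-zeroʳ; ∧-identityʳ; ¬-not) renaming (_≟_ to _≟ᵇ_)
open import Data.Fin using (Fin; zero; suc; toℕ; punchIn; punchOut)
open import Data.Fin.Properties using (_≟_; punchInᵢ≢i; toℕ<n; punchIn-punchOut; all?; any?)
open import Data.List as List using (List; _++_; length; tabulate)
open import Data.List.Properties using (length-++; length-tabulate)
open import Data.List.Relation.Unary.Any using (Any; here; there)
open import Data.List.Relation.Unary.Any.Properties using (++⁺ˡ; ++⁺ʳ; tabulate⁺)
open import Data.Nat using (ℕ; zero; suc; _+_; _*_; _^_; _∸_; _!; _≤_; _<_; z≤n; s≤s; >-nonZero; >-nonZero⁻¹)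
open import Data.Nat.Induction using (<-wellFounded)
open import Data.Nat.Properties hiding (_≟_)
open import Data.Nat.Tactic.RingSolver using (solve-∀)
open import Algebra.Properties.CommutativeSemigroup *-commutativeSemigroup
  using (x∙yz≈y∙xz; xy∙z≈y∙xz; x∙yz≈xz∙y)
open import Algebra.Properties.Semiring.Sum +-*-semiring
  using (sum; sum-cong-≗; ∑-distrib-+; ∑-comm; *-distribˡ-sum; *-distribʳ-sum; sum-replicate-zero; sum-remove)
open import Data.Product using (Σ; _×_; _,_; proj₁; proj₂; ∃)
open import Data.Sum using (_⊎_; inj₁; inj₂)
open import Data.Vec.Functional using (Vector; []; _∷_)
open import Function.Base using (_∘_; _on_)
open import Induction.WellFounded using (WellFounded; Acc; acc)
import Relation.Binary.Construct.On as On
open import Relation.Binary.PropositionalEquality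
open import Relation.Nullary using (Dec; yes; no; ¬_; ⌊_⌋; contradiction; ¬?; _×-dec_; _⊎-dec_; _→-dec_)

𝟙 : Bool → ℕ
𝟙 true  = 1
𝟙 false = 0

𝟙-∧ : ∀ x y → 𝟙 (x ∧ y) ≡ 𝟙 x * 𝟙 y
𝟙-∧ true  y = sym (+-identityʳ (𝟙 y))
𝟙-∧ false y = refl

∧-intro : ∀ {x y} → x ≡ true → y ≡ true → x ∧ y ≡ true
∧-intro refl refl = refl

𝟙-mono : ∀ {x y} → (x ≡ true → y ≡ true) → 𝟙 x ≤ 𝟙 y
𝟙-mono {true}  x⇒y rewrite x⇒y refl = ≤-refl
𝟙-mono {false} x⇒y = z≤n

𝟙-positive : ∀ {x} → 0 < 𝟙 x → x ≡ true
𝟙-positive {true} _ = refl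

to-yes : ∀ {P : Set} (p? : Dec P) → P → ⌊ p? ⌋ ≡ true
to-yes (yes _) _ = refl
to-yes (no ¬p) p = contradiction p ¬p

from-yes : ∀ {P : Set} (p? : Dec P) → ⌊ p? ⌋ ≡ true → P
from-yes (yes p) _ = p

𝟙-dec-mono : ∀ {P Q : Set} (p? : Dec P) (q? : Dec Q) → (P → Q) → 𝟙 ⌊ p? ⌋ ≤ 𝟙 ⌊ q? ⌋
𝟙-dec-mono p? q? P⇒Q = 𝟙-mono λ p≡true → to-yes q? (P⇒Q (from-yes p? p≡true))

𝟙-dec-cong : ∀ {P Q : Set} (p? : Dec P) (q? : Dec Q) → (P → Q) → (Q → P) → 𝟙 ⌊ p? ⌋ ≡ 𝟙 ⌊ q? ⌋
𝟙-dec-cong p? q? P⇒Q Q⇒P = ≤-antisym (𝟙-dec-mono p? q? P⇒Q) (𝟙-dec-mono q? p? Q⇒P)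

𝟙-dec-yes : ∀ {P : Set} (p? : Dec P) → P → 𝟙 ⌊ p? ⌋ ≡ 1
𝟙-dec-yes p? p = cong 𝟙 (to-yes p? p)

δ : ∀ {n} → Fin n → Fin n → ℕ
δ v u = 𝟙 ⌊ u ≟ v ⌋

δ-same : ∀ {n} (v : Fin n) → δ v v ≡ 1
δ-same v = 𝟙-dec-yes (v ≟ v) refl

δ-other : ∀ {n} {u v : Fin n} → u ≢ v → δ v u ≡ 0
δ-other {u = u} {v} u≢v with u ≟ v
... | yes u≡v = contradiction u≡v u≢v
... | no _    = refl

δ-comm : ∀ {n} (u v : Fin n) → δ u v ≡ δ v u
δ-comm u v with u ≟ v
... | yes refl = δ-same u
... | no u≢v   = δ-other (u≢v ∘ sym)

δ-sift : ∀ {n} (v : Fin n) (f : Fin n → ℕ) → sum (λ u → δ v u * f u) ≡ f v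
δ-sift {suc n} v f = begin
  sum (λ u → δ v u * f u)                                       ≡⟨ sum-remove {i = v} (λ u → δ v u * f u) ⟩
  δ v v * f v + sum (λ j → δ v (punchIn v j) * f (punchIn v j)) ≡⟨ cong₂ _+_ (cong (_* f v) (δ-same v)) (sum-cong-≗ off-v) ⟩
  1 * f v + sum {n} (λ _ → 0)                                   ≡⟨ cong₂ _+_ (*-identityˡ (f v)) (sum-replicate-zero n) ⟩
  f v + 0                                                       ≡⟨ +-identityʳ (f v) ⟩
  f v                                                           ∎
  where
  open ≡-Reasoning
  off-v : ∀ j → δ v (punchIn v j) * f (punchIn v j) ≡ 0
  off-v j rewrite δ-other (punchInᵢ≢i v j) = refl

∑-mono : ∀ {n} {f g : Fin n → ℕ} → (∀ i → f i ≤ g i) → sum f ≤ sum g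
∑-mono {zero}  f≤g = z≤n
∑-mono {suc n} f≤g = +-mono-≤ (f≤g zero) (∑-mono (λ i → f≤g (suc i)))

∑-mono-< : ∀ {n} {f g : Fin n → ℕ} → (∀ i → f i ≤ g i) → ∀ j → f j < g j → sum f < sum g
∑-mono-< {suc n} f≤g zero    fj<gj = +-mono-<-≤ fj<gj (∑-mono (λ i → f≤g (suc i)))
∑-mono-< {suc n} f≤g (suc j) fj<gj = +-mono-≤-< (f≤g zero) (∑-mono-< (λ i → f≤g (suc i)) j fj<gj)

∑-positive : ∀ {n} (f : Fin n → ℕ) → 0 < sum f → ∃ λ i → 0 < f i
∑-positive {suc n} f 0<∑ with f zero in f₀
... | suc _ = zero , subst (0 <_) (sym f₀) (s≤s z≤n)
... | zero  = let (i , 0<fi) = ∑-positive (λ i → f (suc i)) 0<∑ in suc i , 0<fi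

∑-zero : ∀ {n} (f : Fin n → ℕ) → sum f ≡ 0 → ∀ i → f i ≡ 0
∑-zero {suc n} f ∑≡0 zero    = m+n≡0⇒m≡0 (f zero) ∑≡0
∑-zero {suc n} f ∑≡0 (suc i) = ∑-zero (λ j → f (suc j)) (m+n≡0⇒n≡0 (f zero) ∑≡0) i

∑*∑ : ∀ {m n} (f : Fin m → ℕ) (g : Fin n → ℕ) → sum f * sum g ≡ sum λ v → sum λ w → f v * g w
∑*∑ f g = trans (*-distribʳ-sum (sum g) f) (sum-cong-≗ λ v → *-distribˡ-sum (f v) g)

bilin : ∀ {n} → (Fin n → Fin n → ℕ) → (Fin n → ℕ) → (Fin n → ℕ) → ℕ
bilin G f g = sum λ u → f u * sum λ w → g w * G u w

module _ {n : ℕ} (G : Fin n → Fin n → ℕ) where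

  bilin-cong : ∀ {f f′ g g′ : Fin n → ℕ} → (∀ u → f u ≡ f′ u) → (∀ w → g w ≡ g′ w) →
               bilin G f g ≡ bilin G f′ g′
  bilin-cong f≗f′ g≗g′ =
    sum-cong-≗ λ u → cong₂ _*_ (f≗f′ u) (sum-cong-≗ λ w → cong (_* G u w) (g≗g′ w))

  bilin-mono : ∀ {f f′ g g′ : Fin n → ℕ} → (∀ u → f u ≤ f′ u) → (∀ w → g w ≤ g′ w) →
               bilin G f g ≤ bilin G f′ g′
  bilin-mono f≤f′ g≤g′ =
    ∑-mono λ u → *-mono-≤ (f≤f′ u) (∑-mono λ w → *-monoˡ-≤ (G u w) (g≤g′ w))

  bilin-+ˡ : ∀ (f f′ g : Fin n → ℕ) → bilin G (λ u → f u + f′ u) g ≡ bilin G f g + bilin G f′ g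
  bilin-+ˡ f f′ g = trans (sum-cong-≗ λ u → *-distribʳ-+ (sum λ w → g w * G u w) (f u) (f′ u))
                          (∑-distrib-+ (λ u → f u * sum λ w → g w * G u w) (λ u → f′ u * sum λ w → g w * G u w))

  bilin-+ʳ : ∀ (f g g′ : Fin n → ℕ) → bilin G f (λ w → g w + g′ w) ≡ bilin G f g + bilin G f g′
  bilin-+ʳ f g g′ = trans (sum-cong-≗ λ u → trans (cong (f u *_) (inner u)) (*-distribˡ-+ (f u) _ _))
                          (∑-distrib-+ (λ u → f u * sum λ w → g w * G u w) (λ u → f u * sum λ w → g′ w * G u w))
    where
    inner : ∀ u → sum (λ w → (g w + g′ w) * G u w) ≡ sum (λ w → g w * G u w) + sum (λ w → g′ w * G u w)
    inner u = trans (sum-cong-≗ λ w → *-distribʳ-+ (G u w) (g w) (g′ w))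
                    (∑-distrib-+ (λ w → g w * G u w) (λ w → g′ w * G u w))

  bilin-expand : ∀ (f f′ : Fin n → ℕ) →
    bilin G (λ u → f u + f′ u) (λ u → f u + f′ u) ≡ bilin G f f + bilin G f f′ + (bilin G f′ f + bilin G f′ f′)
  bilin-expand f f′ = begin
    bilin G (λ u → f u + f′ u) (λ u → f u + f′ u)
      ≡⟨ bilin-+ˡ f f′ (λ u → f u + f′ u) ⟩
    bilin G f (λ u → f u + f′ u) + bilin G f′ (λ u → f u + f′ u)
      ≡⟨ cong₂ _+_ (bilin-+ʳ f f f′) (bilin-+ʳ f′ f f′) ⟩
    bilin G f f + bilin G f f′ + (bilin G f′ f + bilin G f′ f′)
      ∎
    where open ≡-Reasoning

  bilin-sym : (∀ u w → G u w ≡ G w u) → ∀ (f g : Fin n → ℕ) → bilin G f g ≡ bilin G g f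
  bilin-sym G-sym f g = begin
    sum (λ u → f u * sum λ w → g w * G u w)     ≡⟨ sum-cong-≗ (λ u → *-distribˡ-sum (f u) (λ w → g w * G u w)) ⟩
    sum (λ u → sum λ w → f u * (g w * G u w))   ≡⟨ ∑-comm (λ u w → f u * (g w * G u w)) ⟩
    sum (λ w → sum λ u → f u * (g w * G u w))   ≡⟨ sum-cong-≗ (λ w → sum-cong-≗ λ u → swap w u) ⟩
    sum (λ w → sum λ u → g w * (f u * G w u))   ≡⟨ sum-cong-≗ (λ w → *-distribˡ-sum (g w) (λ u → f u * G w u)) ⟨
    sum (λ w → g w * sum λ u → f u * G w u)     ∎
    where
    open ≡-Reasoning
    swap : ∀ w u → f u * (g w * G u w) ≡ g w * (f u * G w u)
    swap w u = trans (x∙yz≈y∙xz (f u) (g w) (G u w)) (cong (λ z → g w * (f u * z)) (G-sym u w))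

  bilin-δ : ∀ v (g : Fin n → ℕ) → bilin G (δ v) g ≡ sum λ w → g w * G v w
  bilin-δ v g = δ-sift v (λ u → sum λ w → g w * G u w)

∣_∣ : ∀ {n} → VSet n → ℕ
∣ S ∣ = sum (λ v → 𝟙 (S v))

count≡∣∣ : ∀ {n} (S : VSet n) → count S ≡ ∣ S ∣
count≡∣∣ {zero}  S = refl
count≡∣∣ {suc n} S with S zero
... | true  = cong suc (count≡∣∣ (λ v → S (suc v)))
... | false = count≡∣∣ (λ v → S (suc v))

member : ∀ {n} (S : VSet n) → 0 < ∣ S ∣ → ∃ λ u → S u ≡ true
member S 0<∣S∣ = let (u , 0<Su) = ∑-positive (𝟙 ∘ S) 0<∣S∣ in u , 𝟙-positive 0<Su

module _ {n : ℕ} where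

  IsTransversal : ∀ {r} → (Fin r → VSet n) → Vector (Fin n) r → Set
  IsTransversal M t = ∀ i → M i (t i) ≡ true

  tsum : ∀ {r} → (Fin r → VSet n) → (Vector (Fin n) r → ℕ) → ℕ
  tsum {zero}  M F = F []
  tsum {suc r} M F = sum λ v → 𝟙 (M zero v) * tsum (M ∘ suc) (λ t → F (v ∷ t))

  tsum-cong : ∀ {r} (M : Fin r → VSet n) {F G : Vector (Fin n) r → ℕ} →
              (∀ t → F t ≡ G t) → tsum M F ≡ tsum M G
  tsum-cong {zero}  M F≡G = F≡G []
  tsum-cong {suc r} M F≡G =
    sum-cong-≗ λ v → cong (𝟙 (M zero v) *_) (tsum-cong (M ∘ suc) (λ t → F≡G (v ∷ t)))

  tsum-mono : ∀ {r} (M : Fin r → VSet n) {F G : Vector (Fin n) r → ℕ} →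
              (∀ t → F t ≤ G t) → tsum M F ≤ tsum M G
  tsum-mono {zero}  M F≤G = F≤G []
  tsum-mono {suc r} M F≤G =
    ∑-mono λ v → *-monoʳ-≤ (𝟙 (M zero v)) (tsum-mono (M ∘ suc) (λ t → F≤G (v ∷ t)))

  tsum-+ : ∀ {r} (M : Fin r → VSet n) (F G : Vector (Fin n) r → ℕ) →
           tsum M (λ t → F t + G t) ≡ tsum M F + tsum M G
  tsum-+ {zero}  M F G = refl
  tsum-+ {suc r} M F G = trans
    (sum-cong-≗ λ v → trans (cong (𝟙 (M zero v) *_) (tsum-+ (M ∘ suc) (λ t → F (v ∷ t)) (λ t → G (v ∷ t))))
                            (*-distribˡ-+ (𝟙 (M zero v)) _ _))
    (∑-distrib-+ (λ v → 𝟙 (M zero v) * tsum (M ∘ suc) (λ t → F (v ∷ t)))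
                 (λ v → 𝟙 (M zero v) * tsum (M ∘ suc) (λ t → G (v ∷ t))))

  tsum-*ˡ : ∀ {r} (M : Fin r → VSet n) c (F : Vector (Fin n) r → ℕ) →
            tsum M (λ t → c * F t) ≡ c * tsum M F
  tsum-*ˡ {zero}  M c F = refl
  tsum-*ˡ {suc r} M c F = trans
    (sum-cong-≗ λ v → trans (cong (𝟙 (M zero v) *_) (tsum-*ˡ (M ∘ suc) c (λ t → F (v ∷ t))))
                            (x∙yz≈y∙xz (𝟙 (M zero v)) c _))
    (sym (*-distribˡ-sum c (λ v → 𝟙 (M zero v) * tsum (M ∘ suc) (λ t → F (v ∷ t)))))

  tsum-*ʳ : ∀ {r} (M : Fin r → VSet n) c (F : Vector (Fin n) r → ℕ) →
            tsum M (λ t → F t * c) ≡ tsum M F * c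
  tsum-*ʳ M c F = trans (tsum-cong M (λ t → *-comm (F t) c)) (trans (tsum-*ˡ M c F) (*-comm c _))

  tsum-sum : ∀ {r m} (M : Fin r → VSet n) (h : Fin m → Vector (Fin n) r → ℕ) →
             tsum M (λ t → sum λ u → h u t) ≡ sum λ u → tsum M (h u)
  tsum-sum {zero}  M h = refl
  tsum-sum {suc r} M h = trans
    (sum-cong-≗ λ v → trans (cong (𝟙 (M zero v) *_) (tsum-sum (M ∘ suc) (λ u t → h u (v ∷ t))))
                            (*-distribˡ-sum (𝟙 (M zero v)) (λ u → tsum (M ∘ suc) (λ t → h u (v ∷ t)))))
    (∑-comm λ v u → 𝟙 (M zero v) * tsum (M ∘ suc) (λ t → h u (v ∷ t)))

  tsum-witness : ∀ {r} (M : Fin r → VSet n) (F : Vector (Fin n) r → ℕ) →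
                 0 < tsum M F → ∃ λ t → IsTransversal M t × 0 < F t
  tsum-witness {zero}  M F 0<F = [] , (λ ()) , 0<F
  tsum-witness {suc r} M F 0<∑ with ∑-positive _ 0<∑
  ... | v , 0<term with M zero v in v∈M₀
  ... | true =
    let (t , t∈M , 0<Ft) = tsum-witness (M ∘ suc) (λ t → F (v ∷ t)) (subst (0 <_) (+-identityʳ _) 0<term)
    in  v ∷ t , (λ { zero → v∈M₀ ; (suc i) → t∈M i }) , 0<Ft

  tsum-nonempty : ∀ {r} (M : Fin r → VSet n) → (∀ i → 0 < ∣ M i ∣) → 0 < tsum M (λ _ → 1)
  tsum-nonempty {zero}  M M≠∅ = s≤s z≤n
  tsum-nonempty {suc r} M M≠∅ =
    subst (0 <_) (*-distribʳ-sum (tsum (M ∘ suc) (λ _ → 1)) (λ v → 𝟙 (M zero v)))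
          (*-mono-< (M≠∅ zero) (tsum-nonempty (M ∘ suc) (M≠∅ ∘ suc)))

  Ignores : ∀ {r} → Fin r → (Vector (Fin n) r → ℕ) → Set
  Ignores i F = ∀ t t′ → (∀ j → j ≢ i → t j ≡ t′ j) → F t ≡ F t′

  tsum-factor : ∀ {r} (M : Fin r → VSet n) i (F : Vector (Fin n) r → ℕ) (g : Fin n → ℕ) → Ignores i F →
    tsum M (λ t → F t * g (t i)) * ∣ M i ∣ ≡ tsum M F * sum (λ v → 𝟙 (M i v) * g v)
  tsum-factor {suc r} M zero F g F-ignores-0 = begin
    sum (λ v → a v * tsum M′ (λ t → F (v ∷ t) * g v)) * sum a
      ≡⟨ cong (_* sum a) (sum-cong-≗ λ v → cong (a v *_) (tsum-*ʳ M′ (g v) (λ t → F (v ∷ t)))) ⟩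
    sum (λ v → a v * (S v * g v)) * sum a
      ≡⟨ ∑*∑ (λ v → a v * (S v * g v)) a ⟩
    sum (λ v → sum λ w → a v * (S v * g v) * a w)
      ≡⟨ sum-cong-≗ (λ v → sum-cong-≗ λ w → swap-S v w) ⟩
    sum (λ v → sum λ w → a w * S w * (a v * g v))
      ≡⟨ ∑-comm (λ v w → a w * S w * (a v * g v)) ⟩
    sum (λ w → sum λ v → a w * S w * (a v * g v))
      ≡⟨ ∑*∑ (λ w → a w * S w) (λ v → a v * g v) ⟨
    sum (λ w → a w * S w) * sum (λ v → a v * g v)
      ∎
    where
    open ≡-Reasoning
    M′ = M ∘ suc
    a : Fin n → ℕ
    a v = 𝟙 (M zero v)
    S : Fin n → ℕ
    S v = tsum M′ (λ t → F (v ∷ t))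
    S-const : ∀ v w → S v ≡ S w
    S-const v w = tsum-cong M′ λ t → F-ignores-0 (v ∷ t) (w ∷ t) λ { zero 0≢0 → contradiction refl 0≢0 ; (suc j) _ → refl }
    swap-S : ∀ v w → a v * (S v * g v) * a w ≡ a w * S w * (a v * g v)
    swap-S v w = trans (rearrange (a v) (S v) (g v) (a w)) (cong (λ x → a w * x * (a v * g v)) (S-const v w))
      where
      rearrange : ∀ x y z u → x * (y * z) * u ≡ u * y * (x * z)
      rearrange = solve-∀
  tsum-factor {suc r} M (suc i) F g F-ignores-i = begin
    sum (λ v → a v * tsum M′ (λ t → F (v ∷ t) * g (t i))) * ∣ M′ i ∣
      ≡⟨ *-distribʳ-sum ∣ M′ i ∣ (λ v → a v * tsum M′ (λ t → F (v ∷ t) * g (t i))) ⟩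
    sum (λ v → a v * tsum M′ (λ t → F (v ∷ t) * g (t i)) * ∣ M′ i ∣)
      ≡⟨ sum-cong-≗ (λ v → trans (*-assoc (a v) _ _) (cong (a v *_) (tsum-factor M′ i (λ t → F (v ∷ t)) g (ignores v)))) ⟩
    sum (λ v → a v * (tsum M′ (λ t → F (v ∷ t)) * sum (λ w → 𝟙 (M′ i w) * g w)))
      ≡⟨ sum-cong-≗ (λ v → *-assoc (a v) _ _) ⟨
    sum (λ v → a v * tsum M′ (λ t → F (v ∷ t)) * sum (λ w → 𝟙 (M′ i w) * g w))
      ≡⟨ *-distribʳ-sum (sum (λ w → 𝟙 (M′ i w) * g w)) (λ v → a v * tsum M′ (λ t → F (v ∷ t))) ⟨
    sum (λ v → a v * tsum M′ (λ t → F (v ∷ t))) * sum (λ w → 𝟙 (M′ i w) * g w)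
      ∎
    where
    open ≡-Reasoning
    M′ = M ∘ suc
    a : Fin n → ℕ
    a v = 𝟙 (M zero v)
    ignores : ∀ v → Ignores i (λ t → F (v ∷ t))
    ignores v t t′ agree = F-ignores-i (v ∷ t) (v ∷ t′) λ { zero _ → refl ; (suc j) j≢i → agree j (j≢i ∘ cong suc) }

  tsum-factor₂ : ∀ {r} (M : Fin r → VSet n) {a b} → a ≢ b →
    (F : Vector (Fin n) r → ℕ) (G : Fin n → Fin n → ℕ) → Ignores a F → Ignores b F →
    tsum M (λ t → F t * G (t a) (t b)) * (∣ M a ∣ * ∣ M b ∣) ≡ tsum M F * bilin G (𝟙 ∘ M a) (𝟙 ∘ M b)
  tsum-factor₂ M {a} {b} a≢b F G F-ignores-a F-ignores-b = begin
    tsum M (λ t → F t * G (t a) (t b)) * (∣ M a ∣ * ∣ M b ∣)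
      ≡⟨ cong (_* (∣ M a ∣ * ∣ M b ∣)) (tsum-cong M sift-a) ⟩
    tsum M (λ t → sum λ u → F-at u t * δ u (t a)) * (∣ M a ∣ * ∣ M b ∣)
      ≡⟨ cong (_* (∣ M a ∣ * ∣ M b ∣)) (tsum-sum M (λ u t → F-at u t * δ u (t a))) ⟩
    sum (λ u → tsum M (λ t → F-at u t * δ u (t a))) * (∣ M a ∣ * ∣ M b ∣)
      ≡⟨ *-distribʳ-sum (∣ M a ∣ * ∣ M b ∣) (λ u → tsum M (λ t → F-at u t * δ u (t a))) ⟩
    sum (λ u → tsum M (λ t → F-at u t * δ u (t a)) * (∣ M a ∣ * ∣ M b ∣))
      ≡⟨ sum-cong-≗ factor-at ⟩
    sum (λ u → tsum M F * (𝟙 (M a u) * sum λ w → 𝟙 (M b w) * G u w))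
      ≡⟨ *-distribˡ-sum (tsum M F) (λ u → 𝟙 (M a u) * sum λ w → 𝟙 (M b w) * G u w) ⟨
    tsum M F * bilin G (𝟙 ∘ M a) (𝟙 ∘ M b)
      ∎
    where
    open ≡-Reasoning
    F-at : Fin n → Vector (Fin n) _ → ℕ
    F-at u t = F t * G u (t b)
    sift-a : ∀ t → F t * G (t a) (t b) ≡ sum λ u → F-at u t * δ u (t a)
    sift-a t = begin
      F t * G (t a) (t b)                           ≡⟨ cong (F t *_) (δ-sift (t a) (λ u → G u (t b))) ⟨
      F t * sum (λ u → δ (t a) u * G u (t b))       ≡⟨ *-distribˡ-sum (F t) (λ u → δ (t a) u * G u (t b)) ⟩
      sum (λ u → F t * (δ (t a) u * G u (t b)))     ≡⟨ sum-cong-≗ (λ u → x∙yz≈xz∙y (F t) (δ (t a) u) (G u (t b))) ⟩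
      sum (λ u → F-at u t * δ (t a) u)              ≡⟨ sum-cong-≗ (λ u → cong (F-at u t *_) (δ-comm (t a) u)) ⟩
      sum (λ u → F-at u t * δ u (t a))              ∎
    F-at-ignores-a : ∀ u → Ignores a (F-at u)
    F-at-ignores-a u t t′ agree = cong₂ _*_ (F-ignores-a t t′ agree) (cong (G u) (agree b (a≢b ∘ sym)))
    factor-at : ∀ u → tsum M (λ t → F-at u t * δ u (t a)) * (∣ M a ∣ * ∣ M b ∣)
                    ≡ tsum M F * (𝟙 (M a u) * sum λ w → 𝟙 (M b w) * G u w)
    factor-at u = begin
      tsum M (λ t → F-at u t * δ u (t a)) * (∣ M a ∣ * ∣ M b ∣)
        ≡⟨ *-assoc (tsum M (λ t → F-at u t * δ u (t a))) ∣ M a ∣ ∣ M b ∣ ⟨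
      tsum M (λ t → F-at u t * δ u (t a)) * ∣ M a ∣ * ∣ M b ∣
        ≡⟨ cong (_* ∣ M b ∣) (tsum-factor M a (F-at u) (δ u) (F-at-ignores-a u)) ⟩
      tsum M (F-at u) * sum (λ v → 𝟙 (M a v) * δ u v) * ∣ M b ∣
        ≡⟨ cong (λ x → tsum M (F-at u) * x * ∣ M b ∣) (trans (sum-cong-≗ λ v → *-comm (𝟙 (M a v)) (δ u v)) (δ-sift u (𝟙 ∘ M a))) ⟩
      tsum M (F-at u) * 𝟙 (M a u) * ∣ M b ∣
        ≡⟨ xy∙z≈y∙xz (tsum M (F-at u)) (𝟙 (M a u)) ∣ M b ∣ ⟩
      𝟙 (M a u) * (tsum M (F-at u) * ∣ M b ∣)
        ≡⟨ cong (𝟙 (M a u) *_) (tsum-factor M b F (G u) F-ignores-b) ⟩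
      𝟙 (M a u) * (tsum M F * sum λ w → 𝟙 (M b w) * G u w)
        ≡⟨ x∙yz≈y∙xz (𝟙 (M a u)) (tsum M F) _ ⟩
      tsum M F * (𝟙 (M a u) * sum λ w → 𝟙 (M b w) * G u w)
        ∎

module Sparsity {n : ℕ} (H : Graph n) where

  adj : Fin n → Fin n → ℕ
  adj u w = 𝟙 (Adj H u w)

  adj-sym : ∀ u w → adj u w ≡ adj w u
  adj-sym u w = cong 𝟙 (Graph.sym H u w)

  -- Twice the number of edges of H[S].
  edges : VSet n → ℕ
  edges S = bilin adj (𝟙 ∘ S) (𝟙 ∘ S)

  _─_ : VSet n → Fin n → VSet n
  (S ─ v) u = S u ∧ not ⌊ u ≟ v ⌋

  ─-⊆ : ∀ S v → (S ─ v) ⊆ S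
  ─-⊆ S v u u∈S─v with S u
  ... | true = refl

  𝟙-─ : ∀ S v → S v ≡ true → ∀ u → 𝟙 (S u) ≡ 𝟙 ((S ─ v) u) + δ v u
  𝟙-─ S v v∈S u with u ≟ v
  ... | yes refl rewrite v∈S = refl
  ... | no _ with S u
  ...   | true  = refl
  ...   | false = refl

  ∣─∣ : ∀ S v → S v ≡ true → ∣ S ∣ ≡ ∣ S ─ v ∣ + 1
  ∣─∣ S v v∈S = trans (sum-cong-≗ (𝟙-─ S v v∈S))
                (trans (∑-distrib-+ (λ u → 𝟙 ((S ─ v) u)) (δ v))
                       (cong (∣ S ─ v ∣ +_) (trans (sum-cong-≗ λ u → sym (*-identityʳ (δ v u))) (δ-sift v (λ _ → 1)))))

  degIn≡ : ∀ S v → degIn H S v ≡ sum λ w → 𝟙 (S w) * adj v w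
  degIn≡ S v = trans (count≡∣∣ (λ u → S u ∧ Adj H v u)) (sum-cong-≗ λ w → 𝟙-∧ (S w) (Adj H v w))

  edges-─ : ∀ d S v → S v ≡ true → degIn H S v ≤ d → edges S ≤ edges (S ─ v) + 2 * d
  edges-─ d S v v∈S deg≤d = begin
    edges S                                              ≡⟨ bilin-cong adj (𝟙-─ S v v∈S) (𝟙-─ S v v∈S) ⟩
    bilin adj (λ u → s′ u + δ v u) (λ u → s′ u + δ v u)  ≡⟨ bilin-expand adj s′ (δ v) ⟩
    edges (S ─ v) + bilin adj s′ (δ v) + (bilin adj (δ v) s′ + bilin adj (δ v) (δ v))
      ≡⟨ cong₂ (λ x y → edges (S ─ v) + x + (bilin adj (δ v) s′ + y)) (bilin-sym adj adj-sym s′ (δ v)) loop-free ⟩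
    edges (S ─ v) + bilin adj (δ v) s′ + (bilin adj (δ v) s′ + 0)
      ≤⟨ +-mono-≤ (+-monoʳ-≤ (edges (S ─ v)) row≤d) (+-monoˡ-≤ 0 row≤d) ⟩
    edges (S ─ v) + d + (d + 0)                          ≡⟨ rearrange (edges (S ─ v)) d ⟩
    edges (S ─ v) + 2 * d                                ∎
    where
    open ≤-Reasoning
    s′ : Fin n → ℕ
    s′ u = 𝟙 ((S ─ v) u)
    row≤d : bilin adj (δ v) s′ ≤ d
    row≤d = begin
      bilin adj (δ v) s′                 ≡⟨ bilin-δ adj v s′ ⟩
      sum (λ w → s′ w * adj v w)         ≤⟨ ∑-mono (λ w → *-monoˡ-≤ (adj v w) (𝟙-mono (─-⊆ S v w))) ⟩
      sum (λ w → 𝟙 (S w) * adj v w)      ≡⟨ degIn≡ S v ⟨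
      degIn H S v                        ≤⟨ deg≤d ⟩
      d                                  ∎
    loop-free : bilin adj (δ v) (δ v) ≡ 0
    loop-free = trans (bilin-δ adj v (δ v)) (trans (δ-sift v (adj v)) (cong 𝟙 (irrefl H v)))
    rearrange : ∀ e d → e + d + (d + 0) ≡ e + 2 * d
    rearrange = solve-∀

  -- Degenerate graphs are sparse: a d-degenerate H[W] has at most d|S| edges
  -- in every H[S] with S ⊆ W (peel off vertices of degree ≤ d one by one).
  sparse : ∀ {d W} → Degenerate d H W → ∀ m S → S ⊆ W → ∣ S ∣ ≡ m → edges S ≤ 2 * d * m
  sparse {d} W-degen zero S S⊆W ∣S∣≡0 = begin
    edges S                      ≤⟨ bilin-mono adj (λ u → ≤-reflexive (∑-zero (𝟙 ∘ S) ∣S∣≡0 u)) (λ w → ≤-refl {𝟙 (S w)}) ⟩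
    bilin adj (λ _ → 0) (𝟙 ∘ S)  ≡⟨ sum-replicate-zero n ⟩
    0                            ≡⟨ *-zeroʳ (2 * d) ⟨
    2 * d * 0                    ∎
    where open ≤-Reasoning
  sparse {d} W-degen (suc m) S S⊆W ∣S∣≡1+m
    with W-degen S S⊆W (member S (subst (0 <_) (sym ∣S∣≡1+m) (s≤s z≤n)))
  ... | v , v∈S , deg≤d = begin
    edges S                  ≤⟨ edges-─ d S v v∈S deg≤d ⟩
    edges (S ─ v) + 2 * d    ≤⟨ +-monoˡ-≤ (2 * d) (sparse W-degen m (S ─ v) (λ u → S⊆W u ∘ ─-⊆ S v u) ∣S─v∣≡m) ⟩
    2 * d * m + 2 * d        ≡⟨ +-comm (2 * d * m) (2 * d) ⟩
    2 * d + 2 * d * m        ≡⟨ *-suc (2 * d) m ⟨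
    2 * d * suc m            ∎
    where
    open ≤-Reasoning
    ∣S─v∣≡m : ∣ S ─ v ∣ ≡ m
    ∣S─v∣≡m = suc-injective (trans (+-comm 1 _) (trans (sym (∣─∣ S v v∈S)) ∣S∣≡1+m))

  edges-between : ∀ {d} (P Q : VSet n) → (∀ u → P u ≡ true → Q u ≡ false) → Degenerate d H (P ∪ Q) →
                  bilin adj (𝟙 ∘ P) (𝟙 ∘ Q) ≤ d * (∣ P ∣ + ∣ Q ∣)
  edges-between {d} P Q disjoint degen = *-cancelˡ-≤ 2 (begin
    2 * e                                     ≡⟨ cong (e +_) (+-identityʳ e) ⟩
    e + e                                     ≡⟨ cong (e +_) (bilin-sym adj adj-sym p q) ⟩
    e + bilin adj q p                         ≤⟨ +-mono-≤ (m≤n+m e (bilin adj p p)) (m≤m+n (bilin adj q p) (bilin adj q q)) ⟩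
    bilin adj p p + e + (bilin adj q p + bilin adj q q)
                                              ≡⟨ bilin-expand adj p q ⟨
    bilin adj (λ u → p u + q u) (λ u → p u + q u)
                                              ≡⟨ bilin-cong adj 𝟙-∪ 𝟙-∪ ⟨
    edges (P ∪ Q)                             ≤⟨ sparse degen ∣ P ∪ Q ∣ (P ∪ Q) (λ _ u∈P∪Q → u∈P∪Q) refl ⟩
    2 * d * ∣ P ∪ Q ∣                         ≡⟨ cong (2 * d *_) (trans (sum-cong-≗ 𝟙-∪) (∑-distrib-+ p q)) ⟩
    2 * d * (∣ P ∣ + ∣ Q ∣)                   ≡⟨ *-assoc 2 d _ ⟩
    2 * (d * (∣ P ∣ + ∣ Q ∣))                 ∎)
    where
    open ≤-Reasoning
    p q : Fin n → ℕ
    p = 𝟙 ∘ P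
    q = 𝟙 ∘ Q
    e = bilin adj p q
    𝟙-∪ : ∀ u → 𝟙 ((P ∪ Q) u) ≡ p u + q u
    𝟙-∪ u with P u in u∈P
    ... | true rewrite disjoint u u∈P = refl
    ... | false = refl


choose : ℕ → ℕ → ℕ
choose n       zero    = 1
choose zero    (suc k) = 0
choose (suc n) (suc k) = choose n k + choose n (suc k)

falling : ℕ → ℕ → ℕ
falling n       zero    = 1
falling zero    (suc k) = 0
falling (suc n) (suc k) = suc n * falling n k

binomial : ∀ n x N → n < N → (1 + x) ^ n ≡ sum {N} λ i → choose n (toℕ i) * x ^ toℕ i
binomial zero    x (suc N) _ = sym (cong suc (sum-replicate-zero N))
binomial (suc n) x (suc N) (s≤s n<N) = sym (begin
  1 * 1 + sum {N} (λ i → (choose n (toℕ i) + choose n (suc (toℕ i))) * (x * x ^ toℕ i))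
    ≡⟨ cong (1 * 1 +_) (sum-cong-≗ {N} λ i → split (choose n (toℕ i)) (choose n (suc (toℕ i))) x (x ^ toℕ i)) ⟩
  1 * 1 + sum {N} (λ i → x * term i + term (suc i))
    ≡⟨ cong (1 * 1 +_) (∑-distrib-+ {N} (λ i → x * term i) (term ∘ suc)) ⟩
  1 * 1 + (sum {N} (λ i → x * term i) + sum {N} (term ∘ suc))
    ≡⟨ cong (λ y → 1 * 1 + (y + sum {N} (term ∘ suc))) (*-distribˡ-sum {N} x term) ⟨
  1 * 1 + (x * sum {N} term + sum {N} (term ∘ suc))
    ≡⟨ regroup (x * sum {N} term) (sum {N} (term ∘ suc)) ⟩
  sum {suc N} term + x * sum {N} term
    ≡⟨ cong₂ (λ y z → y + x * z) (binomial n x (suc N) (m<n⇒m<1+n n<N)) (binomial n x N n<N) ⟨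
  (1 + x) ^ n + x * (1 + x) ^ n
    ∎)
  where
  open ≡-Reasoning
  term : ∀ {N} → Fin N → ℕ
  term i = choose n (toℕ i) * x ^ toℕ i
  split : ∀ a b x y → (a + b) * (x * y) ≡ x * (a * y) + b * (x * y)
  split = solve-∀
  regroup : ∀ y z → 1 * 1 + (y + z) ≡ (1 * 1 + z) + y
  regroup = solve-∀

falling-pascal : ∀ n k → falling (suc n) (suc k) ≡ falling n (suc k) + suc k * falling n k
falling-pascal zero    zero    = refl
falling-pascal zero    (suc k) = sym (*-zeroʳ (suc (suc k)))
falling-pascal (suc n) zero    = base n
  where
  base : ∀ n → (2 + n) * 1 ≡ (1 + n) * 1 + 1 * 1
  base = solve-∀
falling-pascal (suc n) (suc k) = begin
  (2 + n) * (suc n * f)                    ≡⟨ expand (suc n) f ⟩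
  suc n * f + suc n * (suc n * f)          ≡⟨ cong (λ y → suc n * f + suc n * y) (falling-pascal n k) ⟩
  suc n * f + suc n * (A + suc k * f)      ≡⟨ collect (suc n) f A k ⟩
  suc n * A + (2 + k) * (suc n * f)        ∎
  where
  open ≡-Reasoning
  f = falling n k
  A = falling n (suc k)
  expand : ∀ m f → suc m * (m * f) ≡ m * f + m * (m * f)
  expand = solve-∀
  collect : ∀ m f A k → m * f + m * (A + suc k * f) ≡ m * A + (2 + k) * (m * f)
  collect = solve-∀

choose-falling : ∀ n k → choose n k * k ! ≡ falling n k
choose-falling n       zero    = refl
choose-falling zero    (suc k) = refl
choose-falling (suc n) (suc k) = begin
  (choose n k + choose n (suc k)) * (suc k * k !)          ≡⟨ distribute (choose n k) (choose n (suc k)) k (k !) ⟩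
  suc k * (choose n k * k !) + choose n (suc k) * suc k !  ≡⟨ cong₂ (λ x y → suc k * x + y) (choose-falling n k) (choose-falling n (suc k)) ⟩
  suc k * falling n k + falling n (suc k)                  ≡⟨ +-comm (suc k * falling n k) _ ⟩
  falling n (suc k) + suc k * falling n k                  ≡⟨ falling-pascal n k ⟨
  falling (suc n) (suc k)                                  ∎
  where
  open ≡-Reasoning
  distribute : ∀ a b k f → (a + b) * (suc k * f) ≡ suc k * (a * f) + b * (suc k * f)
  distribute = solve-∀

-- (m + k)! ≤ k! (m + k)ᵐ: each of the top m factors is at most m + k.
factorial-bound : ∀ m k → (m + k) ! ≤ k ! * (m + k) ^ m
factorial-bound zero    k = ≤-reflexive (sym (*-identityʳ (k !)))
factorial-bound (suc m) k = begin
  suc (m + k) * (m + k) !                    ≤⟨ *-monoʳ-≤ (suc (m + k)) (factorial-bound m k) ⟩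
  suc (m + k) * (k ! * (m + k) ^ m)          ≤⟨ *-monoʳ-≤ (suc (m + k)) (*-monoʳ-≤ (k !) (^-monoˡ-≤ m (n≤1+n (m + k)))) ⟩
  suc (m + k) * (k ! * suc (m + k) ^ m)      ≡⟨ x∙yz≈y∙xz (suc (m + k)) (k !) _ ⟩
  k ! * (suc (m + k) * suc (m + k) ^ m)      ∎
  where
  open ≤-Reasoning

eNum≡∑falling : ∀ L → eNum L ≡ sum {suc L} λ i → falling L (toℕ i)
eNum≡∑falling zero    = refl
eNum≡∑falling (suc L) = begin
  suc L * eNum L + 1                                  ≡⟨ +-comm (suc L * eNum L) 1 ⟩
  1 + suc L * eNum L                                  ≡⟨ cong (λ e → 1 + suc L * e) (eNum≡∑falling L) ⟩
  1 + suc L * sum {suc L} (λ i → falling L (toℕ i))   ≡⟨ cong (1 +_) (*-distribˡ-sum {suc L} (suc L) (λ i → falling L (toℕ i))) ⟩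
  1 + sum {suc L} (λ i → suc L * falling L (toℕ i))   ∎
  where open ≡-Reasoning

-- Comparing (1 + L)^L = Σ_i (L choose i) Lⁱ with Lᴸ Σ_i 1/(L - i)! termwise.
binomial-term-bound : ∀ L i → i ≤ L → choose L i * L ^ i * L ! ≤ L ^ L * falling L i
binomial-term-bound L i i≤L = begin
  choose L i * L ^ i * L !                      ≡⟨ cong (λ m → choose L i * L ^ i * m !) m+i≡L ⟨
  choose L i * L ^ i * (m + i) !                ≤⟨ *-monoʳ-≤ (choose L i * L ^ i) (factorial-bound m i) ⟩
  choose L i * L ^ i * (i ! * (m + i) ^ m)      ≡⟨ cong (λ l → choose L i * L ^ i * (i ! * l ^ m)) m+i≡L ⟩
  choose L i * L ^ i * (i ! * L ^ m)            ≡⟨ regroup (choose L i) (L ^ i) (i !) (L ^ m) ⟩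
  (choose L i * i !) * (L ^ i * L ^ m)          ≡⟨ cong₂ _*_ (choose-falling L i) (sym (^-distribˡ-+-* L i m)) ⟩
  falling L i * L ^ (i + m)                     ≡⟨ cong (λ j → falling L i * L ^ j) (m+[n∸m]≡n i≤L) ⟩
  falling L i * L ^ L                           ≡⟨ *-comm (falling L i) (L ^ L) ⟩
  L ^ L * falling L i                           ∎
  where
  open ≤-Reasoning
  m = L ∸ i
  m+i≡L : m + i ≡ L
  m+i≡L = m∸n+n≡m i≤L
  regroup : ∀ a b c d → a * b * (c * d) ≡ (a * c) * (b * d)
  regroup = solve-∀

-- (1 + 1/L)^L ≤ Σ_{j ≤ L} 1/j!  (≤ e), cleared of denominators.
e-bound : ∀ L → suc L ^ L * L ! ≤ L ^ L * eNum L
e-bound L = begin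
  suc L ^ L * L !                                          ≡⟨ cong (_* L !) (binomial L L (suc L) ≤-refl) ⟩
  sum {suc L} (λ i → choose L (toℕ i) * L ^ toℕ i) * L !   ≡⟨ *-distribʳ-sum {suc L} (L !) (λ i → choose L (toℕ i) * L ^ toℕ i) ⟩
  sum {suc L} (λ i → choose L (toℕ i) * L ^ toℕ i * L !)   ≤⟨ ∑-mono {suc L} (λ i → binomial-term-bound L (toℕ i) (≤-pred (toℕ<n i))) ⟩
  sum {suc L} (λ i → L ^ L * falling L (toℕ i))            ≡⟨ *-distribˡ-sum {suc L} (L ^ L) (λ i → falling L (toℕ i)) ⟨
  L ^ L * sum {suc L} (λ i → falling L (toℕ i))            ≡⟨ cong (L ^ L *_) (eNum≡∑falling L) ⟨
  L ^ L * eNum L                                           ∎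
  where open ≤-Reasoning


-- For distinct a, b : Fin (2 + q), an enumeration of the q remaining indices.
others : ∀ {q} {a b : Fin (2 + q)} → a ≢ b → Fin q → Fin (2 + q)
others {a = a} a≢b j = punchIn a (punchIn (punchOut a≢b) j)

others-onto : ∀ {q} {a b k : Fin (2 + q)} (a≢b : a ≢ b) → k ≢ a → k ≢ b → ∃ λ j → others a≢b j ≡ k
others-onto {a = a} {b} {k} a≢b k≢a k≢b = punchOut b′≢k′ , (begin
  punchIn a (punchIn b′ (punchOut b′≢k′))  ≡⟨ cong (punchIn a) (punchIn-punchOut b′≢k′) ⟩
  punchIn a k′                             ≡⟨ punchIn-punchOut (k≢a ∘ sym) ⟩
  k                                        ∎)
  where
  open ≡-Reasoning
  k′ = punchOut (k≢a ∘ sym)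
  b′ = punchOut a≢b
  b′≢k′ : b′ ≢ k′
  b′≢k′ b′≡k′ = k≢b (begin
    k             ≡⟨ punchIn-punchOut (k≢a ∘ sym) ⟨
    punchIn a k′  ≡⟨ cong (punchIn a) b′≡k′ ⟨
    punchIn a b′  ≡⟨ punchIn-punchOut a≢b ⟩
    b             ∎)

-- The counting form of the symmetric local lemma, for transversals of a
-- family M of r = 2 + q vertex sets; the events are "t x ∼ t y" for pairs of
-- indices, each depending on at most D = 2q others, and x = 1/K is the
-- conditional probability bound with K = K₁ + 1.
module LocalLemma {n q : ℕ} (H : Graph n) (M : Fin (2 + q) → VSet n) (K₁ : ℕ) where

  open Sparsity H using (adj; adj-sym)

  Index : Set
  Index = Fin (2 + q)

  Tuple : Set
  Tuple = Vector (Fin n) (2 + q)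

  K : ℕ
  K = suc K₁

  -- A constraint set: the pairs of indices whose vertices must be non-adjacent.
  Constraints : Set
  Constraints = Index → Index → Bool

  _⊆ᶜ_ : Constraints → Constraints → Set
  u ⊆ᶜ v = ∀ x y → u x y ≡ true → v x y ≡ true

  size : Constraints → ℕ
  size s = sum λ x → sum λ y → 𝟙 (s x y)

  size-< : ∀ {u v x y} → u ⊆ᶜ v → v x y ≡ true → u x y ≡ false → size u < size v
  size-< {u} {v} {x} {y} u⊆v vxy uxy =
    ∑-mono-< (λ x′ → ∑-mono λ y′ → 𝟙-mono (u⊆v x′ y′)) x
             (∑-mono-< (λ y′ → 𝟙-mono (u⊆v x y′)) y (subst₂ (λ b c → 𝟙 b < 𝟙 c) (sym uxy) (sym vxy) (s≤s z≤n)))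

  Joins : Index → Index → Index × Index → Set
  Joins x y (z , k) = (x ≡ z × y ≡ k) ⊎ (x ≡ k × y ≡ z)

  joins? : ∀ x y p → Dec (Joins x y p)
  joins? x y (z , k) = (x ≟ z ×-dec y ≟ k) ⊎-dec (x ≟ k ×-dec y ≟ z)

  Within : Constraints → Constraints → List (Index × Index) → Set
  Within v u ps = ∀ x y → v x y ≡ true → u x y ≡ true ⊎ Any (Joins x y) ps

  without : Constraints → Index × Index → Constraints
  without s p x y = s x y ∧ not ⌊ joins? x y p ⌋

  without-⊆ : ∀ s p → without s p ⊆ᶜ s
  without-⊆ s p x y = ∧-conicalˡ (s x y) _

  without-apart : ∀ s p x y → without s p x y ≡ true → ¬ Joins x y p
  without-apart s p x y h with joins? x y p
  ... | no ¬joins = ¬joins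
  ... | yes _     = contradiction (trans (sym (∧-zeroʳ (s x y))) h) λ ()

  without-within : ∀ s p → Within s (without s p) List.[ p ]
  without-within s p x y sxy with joins? x y p
  ... | yes joins = inj₂ (here joins)
  ... | no _      = inj₁ (trans (∧-identityʳ (s x y)) sxy)

  Avoids : Constraints → Tuple → Set
  Avoids s t = ∀ x y → s x y ≡ true → Adj H (t x) (t y) ≡ false

  avoids? : ∀ s t → Dec (Avoids s t)
  avoids? s t = all? λ x → all? λ y → (s x y ≟ᵇ true) →-dec (Adj H (t x) (t y) ≟ᵇ false)

  ok : Constraints → Tuple → ℕ
  ok s t = 𝟙 ⌊ avoids? s t ⌋

  ok-anti : ∀ {u v} → u ⊆ᶜ v → ∀ t → ok v t ≤ ok u t
  ok-anti u⊆v t = 𝟙-dec-mono (avoids? _ t) (avoids? _ t) λ avoids x y uxy → avoids x y (u⊆v x y uxy)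

  ok-ignores : ∀ {u} i → (∀ x y → u x y ≡ true → x ≢ i × y ≢ i) → Ignores i (ok u)
  ok-ignores {u} i apart t t′ agree =
    𝟙-dec-cong (avoids? u t) (avoids? u t′) (transfer t t′ agree) (transfer t′ t (λ j j≢i → sym (agree j j≢i)))
    where
    transfer : ∀ t t′ → (∀ j → j ≢ i → t j ≡ t′ j) → Avoids u t → Avoids u t′
    transfer t t′ agree avoids x y uxy =
      subst₂ (λ v w → Adj H v w ≡ false) (agree x (proj₁ (apart x y uxy))) (agree y (proj₂ (apart x y uxy))) (avoids x y uxy)

  N : Constraints → ℕ
  N s = tsum M (ok s)

  Nbad : Constraints → Index → Index → ℕ
  Nbad s a b = tsum M λ t → ok s t * adj (t a) (t b)

  N-anti : ∀ {u v} → u ⊆ᶜ v → N v ≤ N u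
  N-anti u⊆v = tsum-mono M (ok-anti u⊆v)

  Nbad-anti : ∀ {u v} a b → u ⊆ᶜ v → Nbad v a b ≤ Nbad u a b
  Nbad-anti a b u⊆v = tsum-mono M λ t → *-monoˡ-≤ (adj (t a) (t b)) (ok-anti u⊆v t)

  Nbad-sym : ∀ s a b → Nbad s a b ≡ Nbad s b a
  Nbad-sym s a b = tsum-cong M λ t → cong (ok s t *_) (adj-sym (t a) (t b))

  Nbad-zero : ∀ s a b → (∀ t → Avoids s t → Adj H (t a) (t b) ≡ false) → Nbad s a b ≡ 0
  Nbad-zero s a b excluded = trans (tsum-cong M vanish) (tsum-*ˡ M 0 (λ _ → 0))
    where
    vanish : ∀ t → ok s t * adj (t a) (t b) ≡ 0 * 0
    vanish t with avoids? s t
    ... | no _       = refl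
    ... | yes avoids rewrite excluded t avoids = refl

  -- "Given s, the chance that t a ∼ t b is at most 1/K."
  Good : Constraints → Index → Index → Set
  Good s a b = K * Nbad s a b ≤ N s

  good-diagonal : ∀ s a → Good s a a
  good-diagonal s a rewrite Nbad-zero s a a (λ t _ → irrefl H (t a)) | *-zeroʳ K = z≤n

  good-sym : ∀ {s a b} → Good s a b → Good s b a
  good-sym {s} {a} {b} = subst (λ m → K * m ≤ N s) (Nbad-sym s a b)

  good-constrained : ∀ {s a b} → s a b ≡ true → Good s a b
  good-constrained {s} {a} {b} sab rewrite Nbad-zero s a b (λ t avoids → avoids a b sab) | *-zeroʳ K = z≤n

  cost-of-pair : ∀ {before after z k} → Within after before List.[ z , k ] →
                 N before ≤ N after + Nbad before z k
  cost-of-pair {before} {after} {z} {k} within =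
    ≤-trans (tsum-mono M pointwise) (≤-reflexive (tsum-+ M (ok after) λ t → ok before t * adj (t z) (t k)))
    where
    pointwise : ∀ t → ok before t ≤ ok after t + ok before t * adj (t z) (t k)
    pointwise t with avoids? before t
    ... | no _ = z≤n
    ... | yes avoids with Adj H (t z) (t k) in zk
    ...   | true  = m≤n+m 1 (ok after t)
    ...   | false = ≤-reflexive (sym (trans (+-identityʳ (ok after t)) (𝟙-dec-yes (avoids? after t) avoids-after)))
      where
      avoids-after : Avoids after t
      avoids-after x y axy with within x y axy
      ... | inj₁ bxy                          = avoids x y bxy
      ... | inj₂ (here (inj₁ (refl , refl))) = zk
      ... | inj₂ (here (inj₂ (refl , refl))) = trans (Graph.sym H (t x) (t y)) zk

  add-pair : ∀ {before after z k} → Good before z k → Within after before List.[ z , k ] →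
             K₁ * N before ≤ K * N after
  add-pair {before} {after} {z} {k} good within = +-cancelˡ-≤ (N before) _ _ (begin
    N before + K₁ * N before            ≡⟨⟩
    K * N before                        ≤⟨ *-monoʳ-≤ K (cost-of-pair within) ⟩
    K * (N after + Nbad before z k)     ≡⟨ *-distribˡ-+ K (N after) _ ⟩
    K * N after + K * Nbad before z k   ≤⟨ +-monoʳ-≤ (K * N after) good ⟩
    K * N after + N before              ≡⟨ +-comm (K * N after) (N before) ⟩
    N before + K * N after              ∎)
    where open ≤-Reasoning

  GoodBelow : Constraints → Set
  GoodBelow s = ∀ s′ → size s′ < size s → ∀ z k → Good s′ z k

  -- Within a Good-below s, adding one pair always costs at most a factor K₁/K:
  -- either the pair is new to s and the induction hypothesis applies to before,
  -- or it adds nothing.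
  add-pair-below : ∀ {s before after z k} → GoodBelow s → before ⊆ᶜ s → after ⊆ᶜ s →
                   Within after before List.[ z , k ] → K₁ * N before ≤ K * N after
  add-pair-below {s} {before} {after} {z} {k} below before⊆s after⊆s within
    with (s z k ≟ᵇ true) ×-dec (before z k ≟ᵇ false) | (s k z ≟ᵇ true) ×-dec (before k z ≟ᵇ false)
  ... | yes (szk , bzk) | _ = add-pair (below before (size-< before⊆s szk bzk) z k) within
  ... | no _ | yes (skz , bkz) = add-pair (good-sym {before} {k} {z} (below before (size-< before⊆s skz bkz) k z)) within
  ... | no new₁ | no new₂ = *-mono-≤ (n≤1+n K₁) (N-anti after⊆before)
    where
    after⊆before : after ⊆ᶜ before
    after⊆before x y axy with within x y axy
    ... | inj₁ bxy                          = bxy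
    ... | inj₂ (here (inj₁ (refl , refl))) = ¬-not λ bzk → new₁ (after⊆s x y axy , bzk)
    ... | inj₂ (here (inj₂ (refl , refl))) = ¬-not λ bkz → new₂ (after⊆s x y axy , bkz)

  add-pairs-below : ∀ {s} → GoodBelow s → ∀ ps {u v} → u ⊆ᶜ s → v ⊆ᶜ s → Within v u ps →
                    K₁ ^ length ps * N u ≤ K ^ length ps * N v
  add-pairs-below below List.[] u⊆s v⊆s within = *-monoʳ-≤ 1 (N-anti v⊆u)
    where
    v⊆u : _ ⊆ᶜ _
    v⊆u x y vxy with within x y vxy
    ... | inj₁ uxy = uxy
  add-pairs-below {s} below (p List.∷ ps) {u} {v} u⊆s v⊆s within = begin
    K₁ * K₁ ^ length ps * N u      ≡⟨ *-assoc K₁ _ (N u) ⟩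
    K₁ * (K₁ ^ length ps * N u)    ≤⟨ *-monoʳ-≤ K₁ (add-pairs-below below ps u⊆s mid⊆s mid-within) ⟩
    K₁ * (K ^ length ps * N mid)   ≡⟨ x∙yz≈y∙xz K₁ (K ^ length ps) (N mid) ⟩
    K ^ length ps * (K₁ * N mid)   ≤⟨ *-monoʳ-≤ (K ^ length ps) (add-pair-below below mid⊆s v⊆s (without-within v p)) ⟩
    K ^ length ps * (K * N v)      ≡⟨ x∙yz≈y∙xz (K ^ length ps) K (N v) ⟩
    K * (K ^ length ps * N v)      ≡⟨ *-assoc K (K ^ length ps) (N v) ⟨
    K * K ^ length ps * N v        ∎
    where
    open ≤-Reasoning
    mid = without v p
    mid⊆s : mid ⊆ᶜ s
    mid⊆s x y mxy = v⊆s x y (without-⊆ v p x y mxy)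
    mid-within : Within mid u ps
    mid-within x y mxy with within x y (without-⊆ v p x y mxy)
    ... | inj₁ uxy           = inj₁ uxy
    ... | inj₂ (here joins)  = contradiction joins (without-apart v p x y mxy)
    ... | inj₂ (there joins) = inj₂ joins

  apart? : ∀ (a b x : Index) → Dec (x ≢ a × x ≢ b)
  apart? a b x = ¬? (x ≟ a) ×-dec ¬? (x ≟ b)

  data Position (a b x : Index) : Set where
    is-a  : x ≡ a → Position a b x
    is-b  : x ≡ b → Position a b x
    apart : x ≢ a → x ≢ b → Position a b x

  position : ∀ a b x → Position a b x
  position a b x with x ≟ a | x ≟ b
  ... | yes x≡a | _       = is-a x≡a
  ... | no _    | yes x≡b = is-b x≡b
  ... | no x≢a  | no x≢b  = apart x≢a x≢b

  away : Constraints → Index → Index → Constraints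
  away s a b x y = s x y ∧ ⌊ apart? a b x ⌋ ∧ ⌊ apart? a b y ⌋

  away-⊆ : ∀ s a b → away s a b ⊆ᶜ s
  away-⊆ s a b x y = ∧-conicalˡ (s x y) _

  away-apart : ∀ s a b x y → away s a b x y ≡ true → (x ≢ a × x ≢ b) × (y ≢ a × y ≢ b)
  away-apart s a b x y h = from-yes (apart? a b x) (∧-conicalˡ _ ⌊ apart? a b y ⌋ both)
                          , from-yes (apart? a b y) (∧-conicalʳ ⌊ apart? a b x ⌋ _ both)
    where
    both : ⌊ apart? a b x ⌋ ∧ ⌊ apart? a b y ⌋ ≡ true
    both = ∧-conicalʳ (s x y) _ h

  loopless : Constraints → Constraints
  loopless s x y = s x y ∧ ⌊ ¬? (x ≟ y) ⌋

  loopless-⊆ : ∀ s → loopless s ⊆ᶜ s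
  loopless-⊆ s x y = ∧-conicalˡ (s x y) _

  N-loopless : ∀ s → N (loopless s) ≤ N s
  N-loopless s = tsum-mono M λ t → 𝟙-dec-mono (avoids? (loopless s) t) (avoids? s t) (avoids-loops t)
    where
    avoids-loops : ∀ t → Avoids (loopless s) t → Avoids s t
    avoids-loops t avoids x y sxy with x ≟ y
    ... | yes refl = irrefl H (t x)
    ... | no x≢y   = avoids x y (∧-intro sxy (to-yes (¬? (x ≟ y)) x≢y))

  neighbours : ∀ {a b : Index} → a ≢ b → List (Index × Index)
  neighbours {a} {b} a≢b = tabulate (λ j → a , others a≢b j) ++ tabulate (λ j → b , others a≢b j)

  length-neighbours : ∀ {a b : Index} (a≢b : a ≢ b) → length (neighbours a≢b) ≡ q + q
  length-neighbours {a} {b} a≢b =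
    trans (length-++ (tabulate (λ j → a , others a≢b j)))
          (cong₂ _+_ (length-tabulate (λ j → a , others a≢b j)) (length-tabulate (λ j → b , others a≢b j)))

  via-a : ∀ {a b k x y} (a≢b : a ≢ b) → k ≢ a → k ≢ b → Joins x y (a , k) → Any (Joins x y) (neighbours a≢b)
  via-a a≢b k≢a k≢b joins with others-onto a≢b k≢a k≢b
  ... | j , refl = ++⁺ˡ (tabulate⁺ j joins)

  via-b : ∀ {a b k x y} (a≢b : a ≢ b) → k ≢ a → k ≢ b → Joins x y (b , k) → Any (Joins x y) (neighbours a≢b)
  via-b {a} a≢b k≢a k≢b joins with others-onto a≢b k≢a k≢b
  ... | j , refl = ++⁺ʳ (tabulate (λ j → a , others a≢b j)) (tabulate⁺ j joins)

  loopless-within : ∀ {s a b} (a≢b : a ≢ b) → s a b ≡ false → s b a ≡ false →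
                    Within (loopless s) (away s a b) (neighbours a≢b)
  loopless-within {s} {a} {b} a≢b sab sba x y lxy =
    cover (position a b x) (position a b y) (∧-conicalˡ (s x y) _ lxy) (from-yes (¬? (x ≟ y)) (∧-conicalʳ (s x y) _ lxy))
    where
    cover : ∀ {x y} → Position a b x → Position a b y → s x y ≡ true → x ≢ y →
            away s a b x y ≡ true ⊎ Any (Joins x y) (neighbours a≢b)
    cover (is-a refl) (is-a refl) _   x≢y = contradiction refl x≢y
    cover (is-a refl) (is-b refl) sab′ _  = contradiction (trans (sym sab′) sab) λ ()
    cover (is-b refl) (is-a refl) sba′ _  = contradiction (trans (sym sba′) sba) λ ()
    cover (is-b refl) (is-b refl) _   x≢y = contradiction refl x≢y
    cover (is-a refl) (apart y≢a y≢b) _ _ = inj₂ (via-a a≢b y≢a y≢b (inj₁ (refl , refl)))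
    cover (is-b refl) (apart y≢a y≢b) _ _ = inj₂ (via-b a≢b y≢a y≢b (inj₁ (refl , refl)))
    cover (apart x≢a x≢b) (is-a refl) _ _ = inj₂ (via-a a≢b x≢a x≢b (inj₂ (refl , refl)))
    cover (apart x≢a x≢b) (is-b refl) _ _ = inj₂ (via-b a≢b x≢a x≢b (inj₂ (refl , refl)))
    cover {x} {y} (apart x≢a x≢b) (apart y≢a y≢b) sxy _ =
      inj₁ (∧-intro sxy (∧-intro (to-yes (apart? a b x) (x≢a , x≢b)) (to-yes (apart? a b y) (y≢a , y≢b))))

  all-pairs : Constraints
  all-pairs _ _ = true

  smaller-wf : WellFounded (_<_ on size)
  smaller-wf = On.wellFounded size <-wellFounded

  -- The hypotheses of the local lemma: every M i is non-empty, and each bad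
  -- event has probability p ≤ x (1 - x)^D with x = 1/K and D = 2q.
  module _ (nonempty : ∀ i → 0 < ∣ M i ∣) (K₁>0 : 0 < K₁)
           (condition : ∀ a b → a ≢ b →
              K ^ suc (q + q) * bilin adj (𝟙 ∘ M a) (𝟙 ∘ M b) ≤ K₁ ^ (q + q) * (∣ M a ∣ * ∣ M b ∣)) where

    -- When s does not already exclude
    -- t a ∼ t b, drop the constraints touching a or b: the resulting s₀ ignores
    -- t a and t b, so Nbad s₀ a b / N s₀ is the unconditional probability, and
    -- re-adding the 2q neighbouring pairs costs at most (K₁/K)^(2q).
    claim-step : ∀ s → GoodBelow s → ∀ a b → Good s a b
    claim-step s below a b with a ≟ b | s a b in sab | s b a in sba
    ... | yes refl | _     | _    = good-diagonal s a
    ... | no _     | true  | _    = good-constrained sab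
    ... | no _     | false | true = good-sym {s} {b} {a} (good-constrained sba)
    ... | no a≢b   | false | false = *-cancelˡ-≤ X {{>-nonZero X>0}} (begin
      X * (K * Nbad s a b)                         ≤⟨ *-monoʳ-≤ X (*-monoʳ-≤ K (Nbad-anti a b (away-⊆ s a b))) ⟩
      X * (K * Nbad s₀ a b)                        ≡⟨ regroup₁ (K₁ ^ D) (∣ M a ∣ * ∣ M b ∣) K (Nbad s₀ a b) ⟩
      K * K₁ ^ D * (Nbad s₀ a b * (∣ M a ∣ * ∣ M b ∣))
                                                   ≡⟨ cong (K * K₁ ^ D *_) independence ⟩
      K * K₁ ^ D * (N s₀ * E)                      ≡⟨ regroup₂ K (K₁ ^ D) (N s₀) E ⟩
      K * E * (K₁ ^ D * N s₀)                      ≤⟨ *-monoʳ-≤ (K * E) re-add-neighbours ⟩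
      K * E * (K ^ D * N s)                        ≡⟨ regroup₃ K E (K ^ D) (N s) ⟩
      K ^ suc D * E * N s                          ≤⟨ *-monoˡ-≤ (N s) (condition a b a≢b) ⟩
      X * N s                                      ∎)
      where
      open ≤-Reasoning
      D  = q + q
      s₀ = away s a b
      E  = bilin adj (𝟙 ∘ M a) (𝟙 ∘ M b)
      X  = K₁ ^ D * (∣ M a ∣ * ∣ M b ∣)
      X>0 : 0 < X
      X>0 = *-mono-< (m^n>0 K₁ D) (*-mono-< (nonempty a) (nonempty b))
        where instance _ = >-nonZero K₁>0
      independence : Nbad s₀ a b * (∣ M a ∣ * ∣ M b ∣) ≡ N s₀ * E
      independence = tsum-factor₂ M a≢b (ok s₀) adj
        (ok-ignores a λ x y h → let ((x≢a , _) , (y≢a , _)) = away-apart s a b x y h in x≢a , y≢a)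
        (ok-ignores b λ x y h → let ((_ , x≢b) , (_ , y≢b)) = away-apart s a b x y h in x≢b , y≢b)
      re-add-neighbours : K₁ ^ D * N s₀ ≤ K ^ D * N s
      re-add-neighbours = ≤-trans
        (subst (λ m → K₁ ^ m * N s₀ ≤ K ^ m * N (loopless s)) (length-neighbours a≢b)
               (add-pairs-below below (neighbours a≢b) (away-⊆ s a b) (loopless-⊆ s) (loopless-within a≢b sab sba)))
        (*-monoʳ-≤ (K ^ D) (N-loopless s))
      regroup₁ : ∀ x m k g → x * m * (k * g) ≡ k * x * (g * m)
      regroup₁ = solve-∀
      regroup₂ : ∀ k x f e → k * x * (f * e) ≡ k * e * (x * f)
      regroup₂ = solve-∀
      regroup₃ : ∀ k e y f → k * e * (y * f) ≡ k * y * e * f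
      regroup₃ = solve-∀

    claim : ∀ s a b → Good s a b
    claim s = go s (smaller-wf s)
      where
      go : ∀ s → Acc (_<_ on size) s → ∀ a b → Good s a b
      go s (acc smaller) = claim-step s λ s′ s′<s → go s′ (smaller s′<s)

    -- Every constraint set is satisfied by some transversal: removing one
    -- constraint (x, y) from s gives s′ with K₁ N s′ ≤ K N s by the claim.
    positive : ∀ s → 0 < N s
    positive s = go s (smaller-wf s)
      where
      go : ∀ s → Acc (_<_ on size) s → 0 < N s
      go s (acc smaller) with any? (λ x → any? (λ y → s x y ≟ᵇ true))
      ... | no unconstrained = subst (0 <_) (sym (tsum-cong M vacuous)) (tsum-nonempty M nonempty)
        where
        vacuous : ∀ t → ok s t ≡ 1
        vacuous t = 𝟙-dec-yes (avoids? s t) λ x y sxy → contradiction (x , y , sxy) unconstrained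
      ... | yes (x , y , sxy) = *-cancelˡ-< K 0 (N s) (begin-strict
        K * 0        ≡⟨ *-zeroʳ K ⟩
        0            <⟨ *-mono-< K₁>0 (go s′ (smaller (size-< (without-⊆ s (x , y)) sxy s′xy))) ⟩
        K₁ * N s′    ≤⟨ add-pair (claim s′ x y) (without-within s (x , y)) ⟩
        K * N s      ∎)
        where
        open ≤-Reasoning
        s′ = without s (x , y)
        s′xy : s′ x y ≡ false
        s′xy with joins? x y (x , y)
        ... | yes _  = ∧-zeroʳ (s x y)
        ... | no ¬xy = contradiction (inj₁ (refl , refl)) ¬xy

    satisfying-transversal : ∀ s → ∃ λ t → IsTransversal M t × Avoids s t
    satisfying-transversal s with tsum-witness M (ok s) (positive s)
    ... | t , transversal , 0<ok = t , transversal , from-yes (avoids? s t) (𝟙-positive 0<ok)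

    independent-transversal : ∃ λ t → IsTransversal M t × ∀ x y → Adj H (t x) (t y) ≡ false
    independent-transversal =
      let (t , transversal , avoids) = satisfying-transversal all-pairs in t , transversal , λ x y → avoids x y refl

-- Arithmetic of the application, with L = D + 1 = 2r - 3: classes of size at
-- least 2eLd make every pair of classes satisfy the local lemma condition.
local-lemma-condition : ∀ D d m m′ E → E ≤ d * (m + m′) →
  2 * (suc D * d) * eNum (suc D) ≤ m * suc D ! →
  2 * (suc D * d) * eNum (suc D) ≤ m′ * suc D ! →
  suc (suc D) ^ suc D * E ≤ suc D ^ D * (m * m′)
local-lemma-condition D d m m′ E E≤ m-big m′-big = *-cancelˡ-≤ Z {{>-nonZero Z>0}} (begin
  Z * (suc L ^ L * E)              ≡⟨ regroup₁ L (L !) (suc L ^ L) E ⟩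
  2 * L * E * (suc L ^ L * L !)    ≤⟨ *-monoʳ-≤ (2 * L * E) (e-bound L) ⟩
  2 * L * E * (L ^ L * e)          ≡⟨ regroup₂ L E (L ^ L) e ⟩
  L ^ L * (2 * L * e) * E          ≤⟨ *-monoʳ-≤ (L ^ L * (2 * L * e)) E≤ ⟩
  L ^ L * (2 * L * e) * (d * (m + m′))
                                   ≡⟨ regroup₃ (L ^ L) L e d m m′ ⟩
  L ^ L * (c * m + c * m′)         ≤⟨ *-monoʳ-≤ (L ^ L) (+-mono-≤ (*-monoˡ-≤ m m′-big) (*-monoˡ-≤ m′ m-big)) ⟩
  L ^ L * (m′ * L ! * m + m * L ! * m′)
                                   ≡⟨ regroup₄ L (L ^ D) m m′ (L !) ⟩
  Z * (L ^ D * (m * m′))           ∎)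
  where
  open ≤-Reasoning
  L = suc D
  e = eNum L
  c = 2 * (L * d) * e
  Z = 2 * L * L !
  Z>0 : 0 < Z
  Z>0 = *-mono-< (*-mono-< {0} {2} {0} {L} (s≤s z≤n) (s≤s z≤n)) (>-nonZero⁻¹ (L !) {{L !≢0}})
  regroup₁ : ∀ l f k x → 2 * l * f * (k * x) ≡ 2 * l * x * (k * f)
  regroup₁ = solve-∀
  regroup₂ : ∀ l x p e → 2 * l * x * (p * e) ≡ p * (2 * l * e) * x
  regroup₂ = solve-∀
  regroup₃ : ∀ p l e d m m′ → p * (2 * l * e) * (d * (m + m′)) ≡ p * (2 * (l * d) * e * m + 2 * (l * d) * e * m′)
  regroup₃ = solve-∀
  regroup₄ : ∀ l p m m′ f → l * p * (m′ * f * m + m * f * m′) ≡ 2 * l * f * (p * (m * m′))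
  regroup₄ = solve-∀

large-class-nonempty : ∀ D d m → 0 < d → 2 * (suc D * d) * eNum (suc D) ≤ m * suc D ! → 0 < m
large-class-nonempty D d zero    d>0 m-big = contradiction m-big (<⇒≱ required>0)
  where
  required>0 : 0 < 2 * (suc D * d) * eNum (suc D)
  required>0 = *-mono-< (*-mono-< {0} {2} (s≤s z≤n) (*-mono-< {0} {suc D} (s≤s z≤n) d>0)) (m≤n+m 1 _)
large-class-nonempty D d (suc m) d>0 m-big = s≤s z≤n

class-member : ∀ {n r} (c : Fin n → Fin r) i v → class c i v ≡ true → c v ≡ i
class-member c i v v∈i with c v ≟ i
... | yes cv≡i = cv≡i

class-disjoint : ∀ {n r} (c : Fin n → Fin r) {a b} → a ≢ b → ∀ v → class c a v ≡ true → class c b v ≡ false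
class-disjoint c {a} {b} a≢b v v∈a with class c b v in v∈b
... | true  = contradiction (trans (sym (class-member c a v v∈a)) (class-member c b v v∈b)) a≢b
... | false = refl

2r∸3≡L : ∀ q → 2 * (2 + q) ∸ 3 ≡ suc (q + q)
2r∸3≡L q = trans (cong (_∸ 3) (expand q)) (m+n∸m≡n 3 (suc (q + q)))
  where
  expand : ∀ q → 2 * (2 + q) ≡ 3 + suc (q + q)
  expand = solve-∀

lemma11 : (r d n : ℕ) → 2 ≤ r → 1 ≤ d →
    (H : Graph n) → (c : Fin n → Fin r) → ProperColouring H r c →
    (∀ i → AtLeastETimes (count (class c i)) (2 * ((2 * r ∸ 3) * d))) →
    (∀ i j → i ≢ j → Degenerate d H (class c i ∪ class c j)) →
    Σ (Fin r → Fin n) λ x →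
      (∀ i → c (x i) ≡ i) × (∀ i j → Adj H (x i) (x j) ≡ false)
lemma11 (suc (suc q)) d n (s≤s (s≤s _)) d≥1 H c _ large degenerate =
  let (x , transversal , independent) = LocalLemma.independent-transversal H V L nonempty (s≤s z≤n) condition
  in  x , (λ i → class-member c i (x i) (transversal i)) , independent
  where
  V = class c
  L = suc (q + q)
  large′ : ∀ i → 2 * (L * d) * eNum L ≤ ∣ V i ∣ * L !
  large′ i = subst (λ l → 2 * (l * d) * eNum l ≤ ∣ V i ∣ * l !) (2r∸3≡L q)
                   (subst (λ m → _ ≤ m * _) (count≡∣∣ (V i)) (large i (2 * suc (suc q) ∸ 3)))
  nonempty : ∀ i → 0 < ∣ V i ∣
  nonempty i = large-class-nonempty (q + q) d ∣ V i ∣ d≥1 (large′ i)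
  condition : ∀ a b → a ≢ b → suc L ^ L * bilin (Sparsity.adj H) (𝟙 ∘ V a) (𝟙 ∘ V b) ≤ L ^ (q + q) * (∣ V a ∣ * ∣ V b ∣)
  condition a b a≢b = local-lemma-condition (q + q) d ∣ V a ∣ ∣ V b ∣ _
    (Sparsity.edges-between H (V a) (V b) (class-disjoint c a≢b) (degenerate a b a≢b)) (large′ a) (large′ b)
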